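{- A sorted naive shifted parking function $(p,\overline{\sigma})$ of size $n$ is a garage if and only if, for every $i\in[n]$ such that the $i$-th step of its matching path moves towards the diagonal, we have $\upsilon_i=0$.
   Context: A parking function of size $n$ is an $n$-tuple $p$ of positive integers whose $i$-th smallest entry is at most $i$ for each $i$; it is sorted if weakly increasing. $\alpha_k(p)=\#\{j:p_j=k\}$. A sorted naive shifted parking function of size $n$ is a pair $(p,\overline{\sigma})$ with $p$ a sorted parking function of size $n$ and $\overline{\sigma}\in\{ -1,0,1\}^n$ with $\overline{\sigma}_k=0$ iff $\alpha_k(p)=0$. Define $\upsilon\in\{0,1,2\}^n$ by $\upsilon_i=0$ if $\alpha_i(p)=0$, $\upsilon_i=1$ if $\alpha_i(p)$ is odd, $\upsilon_i=2$ if $\alpha_i(p)>0$ is even. $(p,\overline{\sigma})$ is a garage if for all $i<j$ with $\upsilon_i=\upsilon_j=2$ such that every prefix of the word $\upsilon_{i+1}\upsilon_{i+2}\cdots\upsilon_{j-1}$ contains at least as many $2$'s as $0$'s, we have $\overline{\sigma}_i=\overline{\sigma}_j$. Matching path: starting at $(0,0)$, for $i=1,\dots,n$ append a step $L_i$, where "below/above/on the diagonal" refers to the current point $(x,y)$ satisfying $y<x$, $y>x$, $y=x$: $L_i=(0,1)$ (up) if $\upsilon_i=2$ and $\overline{\sigma}_i=1$, or $\upsilon_i=0$ and the path is below the diagonal; $L_i=(1,0)$ (right) if $\upsilon_i=2$ and $\overline{\sigma}_i=-1$, or $\upsilon_i=0$ and the path is above the diagonal; $L_i=(1,1)$ (a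 positive diagonal step) if $\upsilon_i=1$; $L_i=(1,1)$ (a negative diagonal step) if $\upsilon_i=0$ and the path is on the diagonal. A step moves towards the diagonal if it decreases $|x-y|$. -}

module Defs where

open import Data.Nat using (ℕ; zero; suc; _≤_; _<_; _≟_; _<?_; ∣_-_∣)
open import Data.Nat.Properties using ()
open import Data.Integer using (ℤ; +_; -[1+_])
open import Data.Fin using (Fin; toℕ) renaming (_<_ to _<ᶠ_; _≤_ to _≤ᶠ_; _<?_ to _<ᶠ?_)
open import Data.Vec using (Vec; []; _∷_; lookup; tabulate; toList)
open import Data.List using (List; length; filter; map; take; allFin)
open import Data.Product using (_×_; _,_)
open import Data.Sum using (_⊎_)
open import Relation.Binary.PropositionalEquality using (_≡_)
open import Relation.Nullary using (¬_)
open import Relation.Nullary.Decidable using (_×-dec_)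

-- Indices: position i : Fin n stands for the integer (toℕ i + 1) ∈ [n].

Sorted : ∀ {n} → Vec ℕ n → Set
Sorted {n} p = ∀ (i j : Fin n) → i ≤ᶠ j → lookup p i ≤ lookup p j

-- For a sorted tuple the i-th smallest entry is p_i, so the parking
-- condition reads: 1 ≤ p_i ≤ i (entries are positive integers).
SortedParkingFunction : ∀ n → Vec ℕ n → Set
SortedParkingFunction n p =
  Sorted p × (∀ (i : Fin n) → 1 ≤ lookup p i × lookup p i ≤ suc (toℕ i))

count : ℕ → List ℕ → ℕ
count k xs = length (filter (_≟ k) xs)

α : ∀ {n} → ℕ → Vec ℕ n → ℕ
α k p = count k (toList p)

InSigns : ℤ → Set
InSigns s = (s ≡ -[1+ 0 ]) ⊎ (s ≡ + 0) ⊎ (s ≡ + 1)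

SortedNaiveShiftedPF : ∀ n → Vec ℕ n → Vec ℤ n → Set
SortedNaiveShiftedPF n p σ =
  SortedParkingFunction n p ×
  (∀ (k : Fin n) → InSigns (lookup σ k)) ×
  (∀ (k : Fin n) → (lookup σ k ≡ + 0 → α (suc (toℕ k)) p ≡ 0)
                 × (α (suc (toℕ k)) p ≡ 0 → lookup σ k ≡ + 0))

parity : ℕ → ℕ
parity zero = 0
parity (suc zero) = 1
parity (suc (suc m)) = parity m

υval : ℕ → ℕ
υval zero = 0
υval a@(suc _) with parity a
... | zero = 2
... | suc _ = 1

υ : ∀ {n} → Vec ℕ n → Vec ℕ n
υ {n} p = tabulate (λ (i : Fin n) → υval (α (suc (toℕ i)) p))

word : ∀ {n} → Vec ℕ n → Fin n → Fin n → List ℕ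
word {n} u i j =
  map (lookup u) (filter (λ k → (i <ᶠ? k) ×-dec (k <ᶠ? j)) (allFin n))

PrefixCondition : List ℕ → Set
PrefixCondition w = ∀ (m : ℕ) → count 0 (take m w) ≤ count 2 (take m w)

Garage : ∀ n → Vec ℕ n → Vec ℤ n → Set
Garage n p σ =
  ∀ (i j : Fin n) → i <ᶠ j →
    lookup (υ p) i ≡ 2 → lookup (υ p) j ≡ 2 →
    PrefixCondition (word (υ p) i j) →
    lookup σ i ≡ lookup σ j

data Step : Set where
  up right posDiag negDiag : Step

Point : Set
Point = ℕ × ℕ

data Position : Set where
  below above on : Position

position : Point → Position
position (x , y) with y <? x | x <? y
... | Relation.Nullary.yes _ | _ = below
... | Relation.Nullary.no _ | Relation.Nullary.yes _ = above
... | Relation.Nullary.no _ | Relation.Nullary.no _ = on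

-- step L_i from υ_i, σ̄_i and the current point.  (The case υ_i = 2,
-- σ̄_i = 0 cannot occur for a naive shifted parking function; it is
-- sent to posDiag arbitrarily.)
stepOf : ℕ → ℤ → Point → Step
stepOf 2 (+ 1) _ = up
stepOf 2 -[1+ 0 ] _ = right
stepOf 2 _ _ = posDiag
stepOf 1 _ _ = posDiag
stepOf 0 _ pt with position pt
... | below = up
... | above = right
... | on = negDiag
stepOf _ _ _ = posDiag

move : Step → Point → Point
move up (x , y) = (x , suc y)
move right (x , y) = (suc x , y)
move posDiag (x , y) = (suc x , suc y)
move negDiag (x , y) = (suc x , suc y)

pathFrom : ∀ {n} → Point → Vec ℕ n → Vec ℤ n → Vec (Point × Step) n
pathFrom pt [] [] = []
pathFrom pt (u ∷ us) (s ∷ ss) =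
  let L = stepOf u s pt in (pt , L) ∷ pathFrom (move L pt) us ss

matchingPath : ∀ {n} → Vec ℕ n → Vec ℤ n → Vec (Point × Step) n
matchingPath p σ = pathFrom (0 , 0) (υ p) σ

distDiag : Point → ℕ
distDiag (x , y) = ∣ x - y ∣

TowardsDiagonal : Point × Step → Set
TowardsDiagonal (pt , L) = distDiag (move L pt) < distDiag pt

{-# OPTIONS --safe #-}
module Submission where

-- A 1 is a diagonal step, a 0 moves one unit towards
-- the diagonal (or along it), and a 2 moves one unit up or right according to σ̄_i; so only a 0, or a 2
-- taken against the side the path is on, can approach the diagonal. Along a stretch off the diagonal
-- the path keeps its side, and its distance to the diagonal grows by at most #2 − #0, and by at least
-- that much if no 2 approaches. Hence if no 2 approaches, then after a 2 at i the distance stays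
-- positive while the ballot condition holds, so a later 2 at j still finds the path on the side of σ̄_i
-- and moves away only if σ̄_j = σ̄_i. Conversely, if a 2 at j approaches, the last departure from the
-- diagonal before j is a 2 at some i, the word between them is a ballot word, and the path at j lies on
-- the side of σ̄_i, so σ̄_i ≠ σ̄_j although the garage condition applies to i and j.

open import Defs
open import Data.Bool using (true; false)
open import Data.Empty using (⊥-elim)
open import Data.Fin using (Fin; toℕ) renaming (zero to fzero; suc to fsuc)
open import Data.Fin.Properties using (toℕ<n)
open import Data.Integer using (ℤ; 0ℤ; 1ℤ; -1ℤ)
open import Data.List using (List; []; _∷_; [_]; _++_; map; filter; take; applyUpTo; upTo; allFin; tabulate)
open import Data.List.Properties
  using (filter-++; filter-all; filter-none; ++-identityʳ; map-∘; map-cong; map-tabulate; map-applyUpTo)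
open import Data.List.Relation.Unary.All.Properties using (applyUpTo⁺₁)
open import Data.Nat
  using (ℕ; zero; suc; pred; _+_; _∸_; _⊓_; _≤_; _<_; z≤n; s≤s; z<s; s<s; s≤s⁻¹; _≟_; _<?_)
open import Data.Nat.Properties
  using (≤-refl; ≤-reflexive; ≤-trans; <⇒≤; ≤⇒≯; <-irrefl; <-asym; n≤1+n; n<1+n; n≮0; 1+n≢0;
         n≢0⇒n>0; +-assoc; +-comm; +-suc; +-identityʳ; +-monoˡ-≤; +-monoʳ-≤; +-monoʳ-<; +-cancelˡ-≤;
         +-cancelʳ-≤; m≤m+n; m+n∸m≡n; m⊓n≤n; m≤n⇒m⊓n≡m; m≤n⇒m<n∨m≡n; m≤n⇒∃[o]m+o≡n;
         +-commutativeSemigroup; module ≤-Reasoning)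
open import Algebra.Properties.CommutativeSemigroup +-commutativeSemigroup using (xy∙z≈y∙xz; x∙yz≈y∙xz)
open import Data.Product using (_×_; _,_; proj₁; proj₂; ∃-syntax; ∃₂)
open import Data.Sum using (_⊎_; inj₁; inj₂)
open import Data.Vec using (Vec; []; _∷_; lookup)
open import Data.Vec.Properties using (lookup∘tabulate)
open import Function using (_∘_; id)
open import Function.Bundles using (_⇔_; mk⇔)
open import Function.Properties.Equivalence using () renaming (trans to ⇔-trans)
open import Level using (0ℓ)
open import Relation.Nullary using (¬_; yes; no; does)
open import Relation.Nullary.Decidable using (_×-dec_)
open import Relation.Unary using (Pred; Decidable)
open import Relation.Binary.PropositionalEquality
  using (_≡_; _≢_; refl; sym; trans; cong; cong₂; subst; subst₂; module ≡-Reasoning)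

-- Offsets from the diagonal

-- aboveBy m and belowBy m lie at distance suc m from the diagonal.
data Offset : Set where
  onDiagonal      : Offset
  aboveBy belowBy : ℕ → Offset

offset : Point → Offset
offset (zero  , zero)  = onDiagonal
offset (zero  , suc y) = aboveBy y
offset (suc x , zero)  = belowBy x
offset (suc x , suc y) = offset (x , y)

distance : Offset → ℕ
distance onDiagonal  = 0
distance (aboveBy m) = suc m
distance (belowBy m) = suc m

side : Offset → Position
side onDiagonal  = on
side (aboveBy _) = above
side (belowBy _) = below

shift : Step → Offset → Offset
shift up      onDiagonal        = aboveBy 0
shift up      (aboveBy m)       = aboveBy (suc m)
shift up      (belowBy zero)    = onDiagonal
shift up      (belowBy (suc m)) = belowBy m
shift right   onDiagonal        = belowBy 0
shift right   (belowBy m)       = belowBy (suc m)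
shift right   (aboveBy zero)    = onDiagonal
shift right   (aboveBy (suc m)) = aboveBy m
shift posDiag o                 = o
shift negDiag o                 = o

distDiag≡distance : ∀ pt → distDiag pt ≡ distance (offset pt)
distDiag≡distance (zero  , zero)  = refl
distDiag≡distance (zero  , suc y) = refl
distDiag≡distance (suc x , zero)  = refl
distDiag≡distance (suc x , suc y) = distDiag≡distance (x , y)

position-suc : ∀ x y → position (suc x , suc y) ≡ position (x , y)
position-suc x y with suc y <? suc x | suc x <? suc y | y <? x | x <? y
... | yes _ | _     | yes _ | _     = refl
... | yes p | _     | no ¬p | _     = ⊥-elim (¬p (s≤s⁻¹ p))
... | no ¬p | _     | yes p | _     = ⊥-elim (¬p (s<s p))
... | no _  | yes _ | no _  | yes _ = refl
... | no _  | yes p | no _  | no ¬p = ⊥-elim (¬p (s≤s⁻¹ p))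
... | no _  | no ¬p | no _  | yes p = ⊥-elim (¬p (s<s p))
... | no _  | no _  | no _  | no _  = refl

position≡side : ∀ pt → position pt ≡ side (offset pt)
position≡side (zero  , zero)  = refl
position≡side (zero  , suc y) = refl
position≡side (suc x , zero)  = refl
position≡side (suc x , suc y) = trans (position-suc x y) (position≡side (x , y))

offset-move : ∀ L pt → offset (move L pt) ≡ shift L (offset pt)
offset-move up      (zero , zero)        = refl
offset-move up      (zero , suc y)       = refl
offset-move up      (suc zero , zero)    = refl
offset-move up      (suc (suc x) , zero) = refl
offset-move up      (suc x , suc y)      = offset-move up (x , y)
offset-move right   (zero , zero)        = refl
offset-move right   (zero , suc zero)    = refl
offset-move right   (zero , suc (suc y)) = refl
offset-move right   (suc x , zero)       = refl
offset-move right   (suc x , suc y)      = offset-move right (x , y)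
offset-move posDiag _                    = refl
offset-move negDiag _                    = refl

distDiag-move : ∀ L pt → distDiag (move L pt) ≡ distance (shift L (offset pt))
distDiag-move L pt = trans (distDiag≡distance (move L pt)) (cong distance (offset-move L pt))

position-move : ∀ L pt → position (move L pt) ≡ side (shift L (offset pt))
position-move L pt = trans (position≡side (move L pt)) (cong side (offset-move L pt))

data IsSign : ℤ → Set where
  plus  : IsSign 1ℤ
  minus : IsSign -1ℤ

signStep : ∀ {s} → IsSign s → Step
signStep plus  = up
signStep minus = right

signSide : ∀ {s} → IsSign s → Position
signSide plus  = above
signSide minus = below

signSide-injective : ∀ {s t} (σ : IsSign s) (τ : IsSign t) → signSide σ ≡ signSide τ → s ≡ t
signSide-injective plus  plus  _ = refl
signSide-injective minus minus _ = refl

signSide-cong : ∀ {s t} (σ : IsSign s) (τ : IsSign t) → s ≡ t → signSide σ ≡ signSide τ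
signSide-cong plus  plus  _ = refl
signSide-cong minus minus _ = refl

homeward : Position → Step
homeward below = up
homeward above = right
homeward on    = negDiag

distance-shift-≤ : ∀ L o → distance (shift L o) ≤ suc (distance o)
distance-shift-≤ up      onDiagonal        = ≤-refl
distance-shift-≤ up      (aboveBy m)       = ≤-refl
distance-shift-≤ up      (belowBy zero)    = z≤n
distance-shift-≤ up      (belowBy (suc m)) = ≤-trans (n≤1+n (suc m)) (n≤1+n (suc (suc m)))
distance-shift-≤ right   onDiagonal        = ≤-refl
distance-shift-≤ right   (belowBy m)       = ≤-refl
distance-shift-≤ right   (aboveBy zero)    = z≤n
distance-shift-≤ right   (aboveBy (suc m)) = ≤-trans (n≤1+n (suc m)) (n≤1+n (suc (suc m)))
distance-shift-≤ posDiag o                 = n≤1+n (distance o)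
distance-shift-≤ negDiag o                 = n≤1+n (distance o)

distance-homeward : ∀ o → distance (shift (homeward (side o)) o) ≡ pred (distance o)
distance-homeward onDiagonal        = refl
distance-homeward (aboveBy zero)    = refl
distance-homeward (aboveBy (suc m)) = refl
distance-homeward (belowBy zero)    = refl
distance-homeward (belowBy (suc m)) = refl

side-shift : ∀ L o → 1 ≤ distance o → 1 ≤ distance (shift L o) → side (shift L o) ≡ side o
side-shift up      (aboveBy m)       _ _ = refl
side-shift up      (belowBy (suc m)) _ _ = refl
side-shift right   (belowBy m)       _ _ = refl
side-shift right   (aboveBy (suc m)) _ _ = refl
side-shift posDiag o                 _ _ = refl
side-shift negDiag o                 _ _ = refl

shift-away : ∀ {s} (σ : IsSign s) o → ¬ distance (shift (signStep σ) o) < distance o →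
  distance (shift (signStep σ) o) ≡ suc (distance o) × side (shift (signStep σ) o) ≡ signSide σ
shift-away plus  onDiagonal        _        = refl , refl
shift-away plus  (aboveBy m)       _        = refl , refl
shift-away plus  (belowBy zero)    ¬closer  = ⊥-elim (¬closer z<s)
shift-away plus  (belowBy (suc m)) ¬closer  = ⊥-elim (¬closer (n<1+n (suc m)))
shift-away minus onDiagonal        _        = refl , refl
shift-away minus (belowBy m)       _        = refl , refl
shift-away minus (aboveBy zero)    ¬closer  = ⊥-elim (¬closer z<s)
shift-away minus (aboveBy (suc m)) ¬closer  = ⊥-elim (¬closer (n<1+n (suc m)))

shift-ownSide : ∀ {s} (σ : IsSign s) o → side o ≡ signSide σ →
  ¬ distance (shift (signStep σ) o) < distance o
shift-ownSide plus  (aboveBy m) _ closer = <-asym closer (n<1+n (suc m))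
shift-ownSide minus (belowBy m) _ closer = <-asym closer (n<1+n (suc m))

-- Single steps of the matching path

next : ℕ → ℤ → Point → Point
next u s pt = move (stepOf u s pt) pt

Towards : ℕ → ℤ → Point → Set
Towards u s pt = TowardsDiagonal (pt , stepOf u s pt)

stepOf-0 : ∀ s pt → stepOf 0 s pt ≡ homeward (position pt)
stepOf-0 s pt with position pt
... | below = refl
... | above = refl
... | on    = refl

next-≤ : ∀ u s pt → distDiag (next u s pt) ≤ suc (distDiag pt)
next-≤ u s pt =
  subst₂ (λ d d₀ → d ≤ suc d₀) (sym (distDiag-move (stepOf u s pt) pt)) (sym (distDiag≡distance pt))
    (distance-shift-≤ (stepOf u s pt) (offset pt))

next-0 : ∀ s pt → distDiag (next 0 s pt) ≡ pred (distDiag pt)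
next-0 s pt = begin
  distDiag (move (stepOf 0 s pt) pt)                         ≡⟨ cong (λ L → distDiag (move L pt)) (stepOf-0 s pt) ⟩
  distDiag (move (homeward (position pt)) pt)                ≡⟨ distDiag-move (homeward (position pt)) pt ⟩
  distance (shift (homeward (position pt)) (offset pt))
    ≡⟨ cong (λ P → distance (shift (homeward P) (offset pt))) (position≡side pt) ⟩
  distance (shift (homeward (side (offset pt))) (offset pt)) ≡⟨ distance-homeward (offset pt) ⟩
  pred (distance (offset pt))                                ≡⟨ cong pred (distDiag≡distance pt) ⟨
  pred (distDiag pt)                                         ∎
  where open ≡-Reasoning

position-move-stable : ∀ L pt → 1 ≤ distDiag pt → 1 ≤ distDiag (move L pt) →
  position (move L pt) ≡ position pt
position-move-stable L pt far far′
  rewrite distDiag-move L pt | position-move L pt | distDiag≡distance pt | position≡side pt =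
  side-shift L (offset pt) far far′

away-move : ∀ {s} (σ : IsSign s) pt → ¬ distDiag (move (signStep σ) pt) < distDiag pt →
  distDiag (move (signStep σ) pt) ≡ suc (distDiag pt) × position (move (signStep σ) pt) ≡ signSide σ
away-move σ pt rewrite distDiag-move (signStep σ) pt | position-move (signStep σ) pt | distDiag≡distance pt =
  shift-away σ (offset pt)

away-step : ∀ {u s} → u ≡ 2 → (σ : IsSign s) (pt : Point) → ¬ Towards u s pt →
  distDiag (next u s pt) ≡ suc (distDiag pt) × position (next u s pt) ≡ signSide σ
away-step refl plus  = away-move plus
away-step refl minus = away-move minus

ownSide-move : ∀ {s} (σ : IsSign s) pt → position pt ≡ signSide σ →
  ¬ distDiag (move (signStep σ) pt) < distDiag pt
ownSide-move σ pt onSide rewrite distDiag-move (signStep σ) pt | distDiag≡distance pt =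
  shift-ownSide σ (offset pt) (trans (sym (position≡side pt)) onSide)

ownSide⇒¬towards : ∀ {u s} → u ≡ 2 → (σ : IsSign s) (pt : Point) → position pt ≡ signSide σ →
  ¬ Towards u s pt
ownSide⇒¬towards refl plus  = ownSide-move plus
ownSide⇒¬towards refl minus = ownSide-move minus

away⇒ownSide : ∀ {u s} → u ≡ 2 → (σ : IsSign s) (pt : Point) → 1 ≤ distDiag pt → ¬ Towards u s pt →
  position pt ≡ signSide σ
away⇒ownSide {u} {s} u≡2 σ pt far ¬towards with away-step u≡2 σ pt ¬towards
... | farther , onSide =
  trans (sym (position-move-stable (stepOf u s pt) pt far (subst (1 ≤_) (sym farther) (s≤s z≤n)))) onSide

-- Any other letter makes a diagonal step, which keeps distDiag definitionally.
towards⇒0or2 : ∀ u s pt → Towards u s pt → u ≡ 0 ⊎ u ≡ 2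
towards⇒0or2 0                   s pt _       = inj₁ refl
towards⇒0or2 1                   s pt towards = ⊥-elim (<-irrefl refl towards)
towards⇒0or2 2                   s pt _       = inj₂ refl
towards⇒0or2 (suc (suc (suc u))) s pt towards = ⊥-elim (<-irrefl refl towards)

leaves-diagonal : ∀ u s pt → distDiag pt ≡ 0 → 1 ≤ distDiag (next u s pt) → u ≡ 2
leaves-diagonal 0                   s pt onDiag far =
  ⊥-elim (n≮0 (subst (1 ≤_) (trans (next-0 s pt) (cong pred onDiag)) far))
leaves-diagonal 1                   s pt onDiag far = ⊥-elim (n≮0 (subst (1 ≤_) onDiag far))
leaves-diagonal 2                   s pt onDiag far = refl
leaves-diagonal (suc (suc (suc u))) s pt onDiag far = ⊥-elim (n≮0 (subst (1 ≤_) onDiag far))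

suc-pred-≤ : ∀ {d} → 1 ≤ d → suc (pred d) ≤ d
suc-pred-≤ (s≤s _) = ≤-refl

≤-suc-pred : ∀ d → d ≤ suc (pred d)
≤-suc-pred zero    = z≤n
≤-suc-pred (suc d) = ≤-refl

step-upper : ∀ u s pt → 1 ≤ distDiag pt →
  count 0 [ u ] + distDiag (next u s pt) ≤ count 2 [ u ] + distDiag pt
step-upper 0                   s pt far =
  subst (λ d → suc d ≤ distDiag pt) (sym (next-0 s pt)) (suc-pred-≤ far)
step-upper 1                   s pt _   = ≤-refl
step-upper 2                   s pt _   = next-≤ 2 s pt
step-upper (suc (suc (suc u))) s pt _   = ≤-refl

step-lower : ∀ u s pt → (Towards u s pt → u ≡ 0) → (u ≡ 2 → IsSign s) →
  count 2 [ u ] + distDiag pt ≤ count 0 [ u ] + distDiag (next u s pt)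
step-lower 0                   s pt _     _      =
  subst (λ d → distDiag pt ≤ suc d) (sym (next-0 s pt)) (≤-suc-pred _)
step-lower 1                   s pt _     _      = ≤-refl
step-lower 2                   s pt only0 signed =
  ≤-reflexive (sym (proj₁ (away-step refl (signed refl) pt (1+n≢0 ∘ only0))))
step-lower (suc (suc (suc u))) s pt _     _      = ≤-refl

-- Walks along sequences of letters and signs

-- Recursion peels off the first step, so that every suffix of a walk is again a walk (walk-+).
walk : Point → (ℕ → ℕ) → (ℕ → ℤ) → ℕ → Point
walk q f g zero    = q
walk q f g (suc k) = walk (next (f 0) (g 0) q) (f ∘ suc) (g ∘ suc) k

stepAt : Point → (ℕ → ℕ) → (ℕ → ℤ) → ℕ → Point × Step
stepAt q f g k = walk q f g k , stepOf (f k) (g k) (walk q f g k)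

walk-suc : ∀ q f g k → walk q f g (suc k) ≡ next (f k) (g k) (walk q f g k)
walk-suc q f g zero    = refl
walk-suc q f g (suc k) = walk-suc (next (f 0) (g 0) q) (f ∘ suc) (g ∘ suc) k

walk-+ : ∀ q f g s m → walk q f g (s + m) ≡ walk (walk q f g s) (f ∘ (s +_)) (g ∘ (s +_)) m
walk-+ q f g zero    m = refl
walk-+ q f g (suc s) m = walk-+ (next (f 0) (g 0) q) (f ∘ suc) (g ∘ suc) s m

TowardsOnlyAtZeros : Point → (ℕ → ℕ) → (ℕ → ℤ) → Set
TowardsOnlyAtZeros q f g = ∀ k → TowardsDiagonal (stepAt q f g k) → f k ≡ 0

towardsOnlyAtZeros-shift : ∀ {q f g} → TowardsOnlyAtZeros q f g →
  ∀ s → TowardsOnlyAtZeros (walk q f g s) (f ∘ (s +_)) (g ∘ (s +_))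
towardsOnlyAtZeros-shift {q} {f} {g} only0 s k towards =
  only0 (s + k) (subst (Towards (f (s + k)) (g (s + k))) (sym (walk-+ q f g s k)) towards)

Signed : (ℕ → ℕ) → (ℕ → ℤ) → Set
Signed f g = ∀ k → f k ≡ 2 → IsSign (g k)

count-∷ : ∀ z x xs → count z (x ∷ xs) ≡ count z [ x ] + count z xs
count-∷ z x xs with does (x ≟ z)
... | true  = refl
... | false = refl

+-≤-chain : ∀ x y x′ y′ {a b c} → x + a ≤ y + b → x′ + b ≤ y′ + c → (x + x′) + a ≤ (y + y′) + c
+-≤-chain x y x′ y′ {a} {b} {c} first second = begin
  (x + x′) + a ≡⟨ xy∙z≈y∙xz x x′ a ⟩
  x′ + (x + a) ≤⟨ +-monoʳ-≤ x′ first ⟩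
  x′ + (y + b) ≡⟨ x∙yz≈y∙xz x′ y b ⟩
  y + (x′ + b) ≤⟨ +-monoʳ-≤ y second ⟩
  y + (y′ + c) ≡⟨ +-assoc y y′ c ⟨
  (y + y′) + c ∎
  where open ≤-Reasoning

count-∷-chain : ∀ z z′ u xs {a b c} →
  count z [ u ] + a ≤ count z′ [ u ] + b → count z xs + b ≤ count z′ xs + c →
  count z (u ∷ xs) + a ≤ count z′ (u ∷ xs) + c
count-∷-chain z z′ u xs first second rewrite count-∷ z u xs | count-∷ z′ u xs =
  +-≤-chain (count z [ u ]) (count z′ [ u ]) (count z xs) (count z′ xs) first second

count-∷-chainʳ : ∀ z z′ u xs {a b c} →
  count z xs + a ≤ count z′ xs + b → count z [ u ] + b ≤ count z′ [ u ] + c →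
  count z (u ∷ xs) + a ≤ count z′ (u ∷ xs) + c
count-∷-chainʳ z z′ u xs first second
  rewrite count-∷ z u xs | count-∷ z′ u xs
        | +-comm (count z [ u ]) (count z xs) | +-comm (count z′ [ u ]) (count z′ xs) =
  +-≤-chain (count z xs) (count z′ xs) (count z [ u ]) (count z′ [ u ]) first second

walk-upper : ∀ q f g m → (∀ k → k < m → 1 ≤ distDiag (walk q f g k)) →
  count 0 (applyUpTo f m) + distDiag (walk q f g m) ≤ count 2 (applyUpTo f m) + distDiag q
walk-upper q f g zero    _   = ≤-refl
walk-upper q f g (suc m) far =
  count-∷-chainʳ 0 2 (f 0) (applyUpTo (f ∘ suc) m)
    (walk-upper (next (f 0) (g 0) q) (f ∘ suc) (g ∘ suc) m (λ k k<m → far (suc k) (s<s k<m)))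
    (step-upper (f 0) (g 0) q (far 0 z<s))

walk-lower : ∀ q f g m → TowardsOnlyAtZeros q f g → Signed f g →
  count 2 (applyUpTo f m) + distDiag q ≤ count 0 (applyUpTo f m) + distDiag (walk q f g m)
walk-lower q f g zero    _     _      = ≤-refl
walk-lower q f g (suc m) only0 signed =
  count-∷-chain 2 0 (f 0) (applyUpTo (f ∘ suc) m)
    (step-lower (f 0) (g 0) q (only0 0) (signed 0))
    (walk-lower (next (f 0) (g 0) q) (f ∘ suc) (g ∘ suc) m (only0 ∘ suc) (signed ∘ suc))

Ballot : List ℕ → Set
Ballot xs = count 0 xs ≤ count 2 xs

walk-ballot : ∀ q f g m → (∀ k → k < m → 1 ≤ distDiag (walk q f g k)) →
  distDiag q ≤ distDiag (walk q f g m) → Ballot (applyUpTo f m)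
walk-ballot q f g m far notCloser =
  +-cancelʳ-≤ _ _ _ (≤-trans (walk-upper q f g m far) (+-monoʳ-≤ _ notCloser))

ballot⇒walk-≥ : ∀ q f g m → TowardsOnlyAtZeros q f g → Signed f g → Ballot (applyUpTo f m) →
  distDiag q ≤ distDiag (walk q f g m)
ballot⇒walk-≥ q f g m only0 signed ballot =
  +-cancelˡ-≤ (count 2 (applyUpTo f m)) _ _ (≤-trans (walk-lower q f g m only0 signed) (+-monoˡ-≤ _ ballot))

walk-position : ∀ q f g m → (∀ k → k ≤ m → 1 ≤ distDiag (walk q f g k)) →
  position (walk q f g m) ≡ position q
walk-position q f g zero    _   = refl
walk-position q f g (suc m) far =
  trans (walk-position (next (f 0) (g 0) q) (f ∘ suc) (g ∘ suc) m (λ k k≤m → far (suc k) (s≤s k≤m)))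
        (position-move-stable (stepOf (f 0) (g 0) q) q (far 0 z≤n) (far 1 (s≤s z≤n)))

last-zero : ∀ (d : ℕ → ℕ) k → d 0 ≡ 0 → 1 ≤ d k →
  ∃₂ λ a M → suc a + M ≡ k × d a ≡ 0 × (∀ m → m ≤ M → 1 ≤ d (suc a + m))
last-zero d zero    d0≡0 far = ⊥-elim (n≮0 (subst (1 ≤_) d0≡0 far))
last-zero d (suc k) d0≡0 far with d k ≟ 0
... | yes dk≡0 =
  k , 0 , +-identityʳ (suc k) , dk≡0 ,
  λ { _ z≤n → subst (λ i → 1 ≤ d i) (sym (+-identityʳ (suc k))) far }
... | no dk≢0 with last-zero d k d0≡0 (n≢0⇒n>0 dk≢0)
...   | a , M , refl , da≡0 , farBefore = a , suc M , +-suc (suc a) M , da≡0 , farUpTo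
  where
  farUpTo : ∀ m → m ≤ suc M → 1 ≤ d (suc a + m)
  farUpTo m m≤1+M with m≤n⇒m<n∨m≡n m≤1+M
  ... | inj₁ m<1+M = farBefore m (s≤s⁻¹ m<1+M)
  ... | inj₂ refl  = subst (λ i → 1 ≤ d i) (sym (+-suc (suc a) M)) far

-- Garages of sequences

take-applyUpTo : ∀ {A : Set} (h : ℕ → A) m n → take m (applyUpTo h n) ≡ applyUpTo h (m ⊓ n)
take-applyUpTo h zero    n       = refl
take-applyUpTo h (suc m) zero    = refl
take-applyUpTo h (suc m) (suc n) = cong (h 0 ∷_) (take-applyUpTo (h ∘ suc) m n)

prefixCondition-applyUpTo⁻ : ∀ h n → PrefixCondition (applyUpTo h n) →
  ∀ m → m ≤ n → Ballot (applyUpTo h m)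
prefixCondition-applyUpTo⁻ h n ballot m m≤n =
  subst Ballot (trans (take-applyUpTo h m n) (cong (applyUpTo h) (m≤n⇒m⊓n≡m m≤n))) (ballot m)

prefixCondition-applyUpTo⁺ : ∀ h n → (∀ m → m ≤ n → Ballot (applyUpTo h m)) →
  PrefixCondition (applyUpTo h n)
prefixCondition-applyUpTo⁺ h n ballot m =
  subst Ballot (sym (take-applyUpTo h m n)) (ballot (m ⊓ n) (m⊓n≤n m n))

origin : Point
origin = 0 , 0

segment : (ℕ → ℕ) → ℕ → ℕ → List ℕ
segment f a b = applyUpTo (f ∘ (suc a +_)) (b ∸ suc a)

segment-+ : ∀ f a M → segment f a (suc a + M) ≡ applyUpTo (f ∘ (suc a +_)) M
segment-+ f a M = cong (applyUpTo (f ∘ (suc a +_))) (m+n∸m≡n (suc a) M)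

GarageSeq : (ℕ → ℕ) → (ℕ → ℤ) → Set
GarageSeq f g = ∀ a b → a < b → f a ≡ 2 → f b ≡ 2 → PrefixCondition (segment f a b) → g a ≡ g b

module _ {f : ℕ → ℕ} {g : ℕ → ℤ} (signed : Signed f g) where

  private
    P : ℕ → Point
    P = walk origin f g

    after : ℕ → ℕ → Point
    after a = walk (P (suc a)) (f ∘ (suc a +_)) (g ∘ (suc a +_))

  away-at : ∀ k (fk≡2 : f k ≡ 2) → ¬ Towards (f k) (g k) (P k) →
    distDiag (P (suc k)) ≡ suc (distDiag (P k)) × position (P (suc k)) ≡ signSide (signed k fk≡2)
  away-at k fk≡2 ¬towards =
    subst (λ pt → distDiag pt ≡ suc (distDiag (P k)) × position pt ≡ signSide (signed k fk≡2))
          (sym (walk-suc origin f g k)) (away-step fk≡2 (signed k fk≡2) (P k) ¬towards)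

  side-after : ∀ a M (fa≡2 : f a ≡ 2) → ¬ Towards (f a) (g a) (P a) →
    (∀ m → m ≤ M → 1 ≤ distDiag (after a m)) → position (P (suc a + M)) ≡ signSide (signed a fa≡2)
  side-after a M fa≡2 ¬towards far =
    trans (cong position (walk-+ origin f g (suc a) M))
          (trans (walk-position (P (suc a)) _ _ M far) (proj₂ (away-at a fa≡2 ¬towards)))

  towardsOnlyAtZeros⇒garageSeq : TowardsOnlyAtZeros origin f g → GarageSeq f g
  towardsOnlyAtZeros⇒garageSeq only0 a b a<b fa≡2 fb≡2 ballot with m≤n⇒∃[o]m+o≡n a<b
  ... | M , refl =
    signSide-injective (signed a fa≡2) (signed b fb≡2)
      (trans (sym (side-after a M fa≡2 (¬towards a fa≡2) far))
             (away⇒ownSide fb≡2 (signed b fb≡2) (P b) farAtB (¬towards b fb≡2)))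
    where
    ¬towards : ∀ k → f k ≡ 2 → ¬ Towards (f k) (g k) (P k)
    ¬towards k fk≡2 towards = 1+n≢0 (trans (sym fk≡2) (only0 k towards))
    farAtStart : 1 ≤ distDiag (P (suc a))
    farAtStart = subst (1 ≤_) (sym (proj₁ (away-at a fa≡2 (¬towards a fa≡2)))) (s≤s z≤n)
    far : ∀ m → m ≤ M → 1 ≤ distDiag (after a m)
    far m m≤M = ≤-trans farAtStart
      (ballot⇒walk-≥ (P (suc a)) _ _ m (towardsOnlyAtZeros-shift only0 (suc a)) (signed ∘ (suc a +_))
        (prefixCondition-applyUpTo⁻ _ M (subst PrefixCondition (segment-+ f a M) ballot) m m≤M))
    farAtB : 1 ≤ distDiag (P b)
    farAtB = subst (λ pt → 1 ≤ distDiag pt) (sym (walk-+ origin f g (suc a) M)) (far M ≤-refl)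

  garageSeq⇒¬towards2 : GarageSeq f g → ∀ k → f k ≡ 2 → ¬ Towards (f k) (g k) (P k)
  garageSeq⇒¬towards2 garage k fk≡2 towards
    with last-zero (distDiag ∘ P) k refl (≤-trans (s≤s z≤n) towards)
  ... | a , M , refl , onDiagonalAtA , farAbs =
    ownSide⇒¬towards fk≡2 (signed k fk≡2) (P k)
      (trans (side-after a M fa≡2 ¬towardsA far) (signSide-cong (signed a fa≡2) (signed k fk≡2) ga≡gk))
      towards
    where
    far : ∀ m → m ≤ M → 1 ≤ distDiag (after a m)
    far m m≤M = subst (λ pt → 1 ≤ distDiag pt) (walk-+ origin f g (suc a) m) (farAbs m m≤M)
    fa≡2 : f a ≡ 2
    fa≡2 = leaves-diagonal (f a) (g a) (P a) onDiagonalAtA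
             (subst (λ pt → 1 ≤ distDiag pt) (walk-suc origin f g a) (far 0 z≤n))
    ¬towardsA : ¬ Towards (f a) (g a) (P a)
    ¬towardsA towardsA = n≮0 (subst (distDiag (next (f a) (g a) (P a)) <_) onDiagonalAtA towardsA)
    distanceOne : distDiag (P (suc a)) ≡ 1
    distanceOne = trans (proj₁ (away-at a fa≡2 ¬towardsA)) (cong suc onDiagonalAtA)
    ballot : ∀ m → m ≤ M → Ballot (applyUpTo (f ∘ (suc a +_)) m)
    ballot m m≤M = walk-ballot (P (suc a)) _ _ m (λ j j<m → far j (≤-trans (<⇒≤ j<m) m≤M))
                     (subst (_≤ distDiag (after a m)) (sym distanceOne) (far m m≤M))
    ga≡gk : g a ≡ g k
    ga≡gk = garage a k (s≤s (m≤m+n a M)) fa≡2 fk≡2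
              (subst PrefixCondition (sym (segment-+ f a M)) (prefixCondition-applyUpTo⁺ _ M ballot))

  garageSeq⇔towardsOnlyAtZeros : GarageSeq f g ⇔ TowardsOnlyAtZeros origin f g
  garageSeq⇔towardsOnlyAtZeros = mk⇔ garageSeq⇒towardsOnlyAtZeros towardsOnlyAtZeros⇒garageSeq
    where
    garageSeq⇒towardsOnlyAtZeros : GarageSeq f g → TowardsOnlyAtZeros origin f g
    garageSeq⇒towardsOnlyAtZeros garage k towards with towards⇒0or2 (f k) (g k) (P k) towards
    ... | inj₁ fk≡0 = fk≡0
    ... | inj₂ fk≡2 = ⊥-elim (garageSeq⇒¬towards2 garage k fk≡2 towards)

-- Vectors as sequences

-- Reading υ with default 0 beyond the end makes both conditions vacuous there.
nth : ∀ {A : Set} {n} → A → Vec A n → ℕ → A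
nth d []      _       = d
nth d (x ∷ v) zero    = x
nth d (x ∷ v) (suc k) = nth d v k

lookup-nth : ∀ {A : Set} {n} (d : A) (v : Vec A n) i → lookup v i ≡ nth d v (toℕ i)
lookup-nth d (x ∷ v) fzero    = refl
lookup-nth d (x ∷ v) (fsuc i) = lookup-nth d v i

nth≢default⇒index : ∀ {A : Set} {n} {d : A} (v : Vec A n) k → nth d v k ≢ d → ∃[ i ] toℕ {n} i ≡ k
nth≢default⇒index []      k       nonDefault = ⊥-elim (nonDefault refl)
nth≢default⇒index (x ∷ v) zero    _          = fzero , refl
nth≢default⇒index (x ∷ v) (suc k) nonDefault with nth≢default⇒index v k nonDefault
... | i , refl = fsuc i , refl

lookup-pathFrom : ∀ {n} q (u : Vec ℕ n) (σ : Vec ℤ n) d e i →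
  lookup (pathFrom q u σ) i ≡ stepAt q (nth d u) (nth e σ) (toℕ i)
lookup-pathFrom q (x ∷ u) (s ∷ σ) d e fzero    = refl
lookup-pathFrom q (x ∷ u) (s ∷ σ) d e (fsuc i) = lookup-pathFrom (move (stepOf x s q) q) u σ d e i

filter-map : ∀ {A B : Set} {P : Pred B 0ℓ} (h : A → B) (P? : Decidable P) xs →
  filter P? (map h xs) ≡ map h (filter (P? ∘ h) xs)
filter-map h P? []       = refl
filter-map h P? (x ∷ xs) with does (P? (h x))
... | true  = cong (h x ∷_) (filter-map h P? xs)
... | false = filter-map h P? xs

tabulate-∘toℕ : ∀ {A : Set} n (h : ℕ → A) → tabulate {n = n} (h ∘ toℕ) ≡ applyUpTo h n
tabulate-∘toℕ zero    h = refl
tabulate-∘toℕ (suc n) h = cong (h 0 ∷_) (tabulate-∘toℕ n (h ∘ suc))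

map-toℕ-allFin : ∀ n → map toℕ (allFin n) ≡ upTo n
map-toℕ-allFin n = trans (map-tabulate id toℕ) (tabulate-∘toℕ n id)

applyUpTo-+ : ∀ {A : Set} (h : ℕ → A) m n →
  applyUpTo h (m + n) ≡ applyUpTo h m ++ applyUpTo (h ∘ (m +_)) n
applyUpTo-+ h zero    n = refl
applyUpTo-+ h (suc m) n = cong (h 0 ∷_) (applyUpTo-+ (h ∘ suc) m n)

between? : ∀ a b → Decidable (λ k → a < k × k < b)
between? a b k = (a <? k) ×-dec (k <? b)

filter-between-upTo : ∀ {a b n} → a < b → b ≤ n →
  filter (between? a b) (upTo n) ≡ applyUpTo (suc a +_) (b ∸ suc a)
filter-between-upTo {a} a<b b≤n with m≤n⇒∃[o]m+o≡n a<b
... | M , refl with m≤n⇒∃[o]m+o≡n b≤n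
...   | R , refl = begin
  filter B (applyUpTo id (b + R))
    ≡⟨ cong (filter B) (applyUpTo-+ id b R) ⟩
  filter B (applyUpTo id b ++ applyUpTo (b +_) R)
    ≡⟨ cong (λ xs → filter B (xs ++ applyUpTo (b +_) R)) (applyUpTo-+ id (suc a) M) ⟩
  filter B ((upTo (suc a) ++ applyUpTo (suc a +_) M) ++ applyUpTo (b +_) R)
    ≡⟨ filter-++ B (upTo (suc a) ++ applyUpTo (suc a +_) M) (applyUpTo (b +_) R) ⟩
  filter B (upTo (suc a) ++ applyUpTo (suc a +_) M) ++ filter B (applyUpTo (b +_) R)
    ≡⟨ cong₂ _++_ (filter-++ B (upTo (suc a)) (applyUpTo (suc a +_) M))
                  (filter-none B (applyUpTo⁺₁ (b +_) R (λ _ → beyond))) ⟩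
  (filter B (upTo (suc a)) ++ filter B (applyUpTo (suc a +_) M)) ++ []
    ≡⟨ ++-identityʳ _ ⟩
  filter B (upTo (suc a)) ++ filter B (applyUpTo (suc a +_) M)
    ≡⟨ cong₂ _++_ (filter-none B (applyUpTo⁺₁ id (suc a) before))
                  (filter-all B (applyUpTo⁺₁ (suc a +_) M inside)) ⟩
  applyUpTo (suc a +_) M
    ≡⟨ cong (applyUpTo (suc a +_)) (m+n∸m≡n (suc a) M) ⟨
  applyUpTo (suc a +_) (b ∸ suc a) ∎
  where
  open ≡-Reasoning
  b = suc a + M
  B = between? a b
  before : ∀ {k} → k < suc a → ¬ (a < k × k < b)
  before k<1+a (a<k , _) = ≤⇒≯ (s≤s⁻¹ k<1+a) a<k
  inside : ∀ {k} → k < M → a < suc a + k × suc a + k < b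
  inside k<M = s≤s (m≤m+n a _) , +-monoʳ-< (suc a) k<M
  beyond : ∀ {k} → ¬ (a < b + k × b + k < b)
  beyond {k} (_ , b+k<b) = ≤⇒≯ (m≤m+n b k) b+k<b

word≡segment : ∀ {n} (u : Vec ℕ n) (i j : Fin n) → toℕ i < toℕ j →
  word u i j ≡ segment (nth 0 u) (toℕ i) (toℕ j)
word≡segment {n} u i j i<j = begin
  map (lookup u) (filter (between? a b ∘ toℕ) (allFin n))      ≡⟨ map-cong (lookup-nth 0 u) _ ⟩
  map (nth 0 u ∘ toℕ) (filter (between? a b ∘ toℕ) (allFin n)) ≡⟨ map-∘ _ ⟩
  map (nth 0 u) (map toℕ (filter (between? a b ∘ toℕ) (allFin n)))
    ≡⟨ cong (map (nth 0 u)) (filter-map toℕ (between? a b) (allFin n)) ⟨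
  map (nth 0 u) (filter (between? a b) (map toℕ (allFin n)))
    ≡⟨ cong (map (nth 0 u) ∘ filter (between? a b)) (map-toℕ-allFin n) ⟩
  map (nth 0 u) (filter (between? a b) (upTo n))
    ≡⟨ cong (map (nth 0 u)) (filter-between-upTo i<j (<⇒≤ (toℕ<n j))) ⟩
  map (nth 0 u) (applyUpTo (suc a +_) (b ∸ suc a))             ≡⟨ map-applyUpTo (suc a +_) (nth 0 u) (b ∸ suc a) ⟩
  segment (nth 0 u) a b                                         ∎
  where
  open ≡-Reasoning
  a = toℕ i
  b = toℕ j

isSign : ∀ {s} → InSigns s → s ≢ 0ℤ → IsSign s
isSign (inj₁ refl)        _    = minus
isSign (inj₂ (inj₁ refl)) s≢0ℤ = ⊥-elim (s≢0ℤ refl)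
isSign (inj₂ (inj₂ refl)) _    = plus

≡2⇒≢0 : ∀ {m} → m ≡ 2 → m ≢ 0
≡2⇒≢0 refl ()

signed-υ : ∀ {n} (p : Vec ℕ n) (σ : Vec ℤ n) → (∀ k → InSigns (lookup σ k)) →
  (∀ k → lookup σ k ≡ 0ℤ → α (suc (toℕ k)) p ≡ 0) → Signed (nth 0 (υ p)) (nth 0ℤ σ)
signed-υ p σ inSigns unsignedOnlyIfAbsent k uk≡2 with nth≢default⇒index (υ p) k (≡2⇒≢0 uk≡2)
... | i , refl = subst IsSign (lookup-nth 0ℤ σ i) (isSign (inSigns i) σi≢0ℤ)
  where
  σi≢0ℤ : lookup σ i ≢ 0ℤ
  σi≢0ℤ σi≡0ℤ = 1+n≢0 (begin
    2                        ≡⟨ uk≡2 ⟨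
    nth 0 (υ p) (toℕ i)      ≡⟨ lookup-nth 0 (υ p) i ⟨
    lookup (υ p) i           ≡⟨ lookup∘tabulate _ i ⟩
    υval (α (suc (toℕ i)) p) ≡⟨ cong υval (unsignedOnlyIfAbsent i σi≡0ℤ) ⟩
    0                        ∎)
    where open ≡-Reasoning

garage⇔garageSeq : ∀ {n} (p : Vec ℕ n) (σ : Vec ℤ n) →
  Garage n p σ ⇔ GarageSeq (nth 0 (υ p)) (nth 0ℤ σ)
garage⇔garageSeq p σ = mk⇔ toSeq fromSeq
  where
  open ≡-Reasoning
  toSeq : Garage _ p σ → GarageSeq (nth 0 (υ p)) (nth 0ℤ σ)
  toSeq garage a b a<b ua≡2 ub≡2 ballot
    with nth≢default⇒index (υ p) a (≡2⇒≢0 ua≡2) | nth≢default⇒index (υ p) b (≡2⇒≢0 ub≡2)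
  ... | i , refl | j , refl = begin
    nth 0ℤ σ (toℕ i) ≡⟨ lookup-nth 0ℤ σ i ⟨
    lookup σ i       ≡⟨ garage i j a<b (trans (lookup-nth 0 (υ p) i) ua≡2) (trans (lookup-nth 0 (υ p) j) ub≡2)
                                (subst PrefixCondition (sym (word≡segment (υ p) i j a<b)) ballot) ⟩
    lookup σ j       ≡⟨ lookup-nth 0ℤ σ j ⟩
    nth 0ℤ σ (toℕ j) ∎
  fromSeq : GarageSeq (nth 0 (υ p)) (nth 0ℤ σ) → Garage _ p σ
  fromSeq garage i j i<j ui≡2 uj≡2 ballot = begin
    lookup σ i       ≡⟨ lookup-nth 0ℤ σ i ⟩
    nth 0ℤ σ (toℕ i) ≡⟨ garage (toℕ i) (toℕ j) i<j (trans (sym (lookup-nth 0 (υ p) i)) ui≡2)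
                                (trans (sym (lookup-nth 0 (υ p) j)) uj≡2)
                                (subst PrefixCondition (word≡segment (υ p) i j i<j) ballot) ⟩
    nth 0ℤ σ (toℕ j) ≡⟨ lookup-nth 0ℤ σ j ⟨
    lookup σ j       ∎

towardsOnlyAtZeros⇔pathFrom : ∀ {n} q (u : Vec ℕ n) (σ : Vec ℤ n) →
  TowardsOnlyAtZeros q (nth 0 u) (nth 0ℤ σ) ⇔
    (∀ i → TowardsDiagonal (lookup (pathFrom q u σ) i) → lookup u i ≡ 0)
towardsOnlyAtZeros⇔pathFrom q u σ = mk⇔ toFin fromFin
  where
  toFin : TowardsOnlyAtZeros q (nth 0 u) (nth 0ℤ σ) →
    ∀ i → TowardsDiagonal (lookup (pathFrom q u σ) i) → lookup u i ≡ 0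
  toFin only0 i towards =
    trans (lookup-nth 0 u i) (only0 (toℕ i) (subst TowardsDiagonal (lookup-pathFrom q u σ 0 0ℤ i) towards))
  fromFin : (∀ i → TowardsDiagonal (lookup (pathFrom q u σ) i) → lookup u i ≡ 0) →
    TowardsOnlyAtZeros q (nth 0 u) (nth 0ℤ σ)
  fromFin only0 k towards with nth 0 u k ≟ 0
  ... | yes uk≡0 = uk≡0
  ... | no uk≢0 with nth≢default⇒index u k uk≢0
  ...   | i , refl =
    trans (sym (lookup-nth 0 u i)) (only0 i (subst TowardsDiagonal (sym (lookup-pathFrom q u σ 0 0ℤ i)) towards))

lemma3p3 : (n : ℕ) (p : Vec ℕ n) (σ : Vec ℤ n) →
    SortedNaiveShiftedPF n p σ →
    Garage n p σ ⇔
      (∀ (i : Fin n) → TowardsDiagonal (lookup (matchingPath p σ) i) →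
        lookup (υ p) i ≡ 0)
lemma3p3 n p σ (_ , inSigns , unsignedIffAbsent) =
  ⇔-trans (garage⇔garageSeq p σ)
    (⇔-trans (garageSeq⇔towardsOnlyAtZeros (signed-υ p σ inSigns (proj₁ ∘ unsignedIffAbsent)))
             (towardsOnlyAtZeros⇔pathFrom origin (υ p) σ))
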